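{- Let $G=(V,E)$ be a finite undirected graph with the live-edge sampling described in the context. For any set $A\subseteq V$ and any two different vertices $u,v\notin A$ (such that the event $\{u\}\xrightarrow{A}v$ has positive probability), $$\Pr\big(A\to u\ \big|\ \{u\}\xrightarrow{A}v\big)\le\frac{|A|}{|A|+1}.$$
   Context: Each undirected edge $\{x,y\}$ is regarded as the two directed edges $(x,y)$ and $(y,x)$. Live-edge sampling: every vertex $w$ with at least one neighbour independently selects exactly one of its incoming directed edges uniformly at random and declares it "live". From any vertex $w$ the reverse walk follows live edges backwards (from the current vertex to the tail of its live incoming edge), stopping when a vertex is revisited. For sets $A,B\subseteq V$ and a vertex $w$, the event $A\xrightarrow{B}w$ is: the reverse walk from $w$ reaches a vertex of $A$ (stopping at the first such vertex) before revisiting a vertex, and no vertex visited strictly between $w$ and that vertex of $A$ lies in $B$; if $w\in A$ the event holds with probability $1$. $A\to w$ denotes $A\xrightarrow{\emptyset}w$, i.e. $w$ is reachable from $A$ via live edges. -}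

module Defs where

open import Data.Bool using (Bool; true; false; if_then_else_; _∧_; T)
open import Data.Nat using (ℕ; zero; suc; _+_; _>_; NonZero; >-nonZero)
open import Data.Fin using (Fin; _≟_)
open import Data.Fin.Subset using (Subset; _∈_; _∉_; ∣_∣; ⊥)
open import Data.Fin.Subset.Properties using (_∈?_)
open import Data.List using (List; []; _∷_; map; concatMap; filter; length; allFin)
open import Data.Bool.ListAction using (any)
open import Data.Vec using (Vec; []; _∷_; lookup; tabulate)
open import Data.Maybe using (Maybe; just; nothing)
open import Data.Integer using (+_)
open import Data.Rational using (ℚ; _/_)
open import Relation.Nullary.Decidable using (⌊_⌋)
open import Relation.Binary.PropositionalEquality using (_≡_)

record Graph (n : ℕ) : Set where
  field
    adj     : Fin n → Fin n → Bool
    adj-sym : ∀ x y → adj x y ≡ adj y x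
    adj-irr : ∀ x → adj x x ≡ false
open Graph public

neighbours : ∀ {n} → Graph n → Fin n → List (Fin n)
neighbours G w = filter (λ x → T? (adj G x w)) (allFin _)
  where
  open import Data.Bool.Properties using (T?)

-- A live-edge sample: for each vertex w, the tail of its live incoming
-- edge (nothing iff w has no neighbour).
Sample : ℕ → Set
Sample n = Vec (Maybe (Fin n)) n

options : ∀ {n} → Graph n → Fin n → List (Maybe (Fin n))
options G w with neighbours G w
... | []     = nothing ∷ []
... | x ∷ xs = map just (x ∷ xs)

product : ∀ {A : Set} {m} → Vec (List A) m → List (Vec A m)
product []         = [] ∷ []
product (os ∷ oss) = concatMap (λ o → map (o ∷_) (product oss)) os

-- the sample space: all live-edge samples, each of equal probability
-- (independent uniform choices per vertex ⇒ uniform on the product)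
samples : ∀ {n} → Graph n → List (Sample n)
samples G = product (tabulate (options G))

_∈ᵇ_ : ∀ {n} → Fin n → Subset n → Bool
x ∈ᵇ S = ⌊ x ∈? S ⌋

_∈ˡ_ : ∀ {n} → Fin n → List (Fin n) → Bool
x ∈ˡ xs = any (λ z → ⌊ z ≟ x ⌋) xs

-- One step of the reverse walk, with fuel; vis = vertices visited so far,
-- x = current vertex.
walk : ∀ {n} → Sample n → Subset n → Subset n → ℕ → List (Fin n) → Fin n → Bool
walk s A B zero    vis x = false
walk s A B (suc k) vis x with lookup s x
... | nothing = false
... | just y  =
  if y ∈ˡ vis then false
  else if y ∈ᵇ A then true
  else if y ∈ᵇ B then false
  else walk s A B k (y ∷ vis) y

-- The event  A --B--> w  in sample s   (fuel n suffices: ≤ n distinct vertices)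
reachAvoid : ∀ {n} → Sample n → Subset n → Subset n → Fin n → Bool
reachAvoid {n} s A B w = if w ∈ᵇ A then true else walk s A B n (w ∷ []) w

reach : ∀ {n} → Sample n → Subset n → Fin n → Bool
reach s A w = reachAvoid s A ⊥ w

count : ∀ {n} → Graph n → (Sample n → Bool) → ℕ
count G E = length (filter (λ s → T? (E s)) (samples G))
  where
  open import Data.Bool.Properties using (T?)

condPr : ∀ {n} → (G : Graph n) → (E F : Sample n → Bool) → count G F > 0 → ℚ
condPr G E F pos = _/_ (+ count G (λ s → E s ∧ F s)) (count G F) ⦃ >-nonZero pos ⦄

module Submission where

-- Condition on {u} →^A v and let p be the vertex through which the reverse walk from v
-- enters u.  In a sample where moreover A → u, follow the reverse walk from u (entered from p)
-- to the last vertex z before it hits A, say at a ∈ A, and let w be the vertex visited just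
-- before z.  Redirecting the live edge of z to come from w (an edge of G: the live edge of w
-- comes from z) closes the 2-cycle z ⇄ w, so A no longer reaches u; the walk from v, none of
-- whose vertices has its live edge coming from A, is untouched.  The redirected sample and a
-- determine the original one, because z is the first vertex of the reverse walk from u whose
-- live edge comes from the vertex visited just before it.  Hence
-- #(A → u ∧ F) ≤ |A| · #(¬ A → u ∧ F) for F = {u} →^A v, which is the claimed bound.

open import Defs
open import Data.Nat as ℕ using (ℕ; zero; suc; _+_; _*_; _>_; NonZero)
import Data.Nat.Properties as ℕ
open import Data.Integer as ℤ using (+_; +≤+)
open import Data.Integer.Properties using (pos-*)
open import Data.Rational using (_/_; _≤_)
open import Data.Rational.Properties using (toℚᵘ-cancel-≤; toℚᵘ-fromℚᵘ)
open import Data.Rational.Unnormalised using (mkℚᵘ; *≤*)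
import Data.Rational.Unnormalised.Properties as ℚᵘ
open import Data.Bool using (Bool; true; false; T; not; _∧_; if_then_else_)
open import Data.Bool.Properties using (T?; T-∧; T-≡)
open import Function.Bundles using (Equivalence)
open import Data.Fin as Fin using (Fin; _≟_)
open import Data.Fin.Subset as Subset using (Subset; _∉_; ∣_∣; ⁅_⁆; ⊥)
open import Data.Fin.Subset.Properties using (_∈?_; ∉⊥; x∈⁅x⁆; x∈⁅y⁆⇒x≡y)
open import Data.List using (List; []; _∷_; _++_; length; map; filter; cartesianProductWith; allFin)
open import Data.List.Properties using (length-++; length-map; length-removeAt′)
open import Data.List.Membership.Propositional using (_∈_)
open import Data.List.Membership.Propositional.Properties
  using (∈-map⁺; ∈-map⁻; ∈-filter⁺; ∈-filter⁻; ∈-allFin;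
         ∈-cartesianProductWith⁺; ∈-cartesianProductWith⁻)
open import Data.List.Relation.Binary.Subset.Propositional using (_⊆_)
open import Data.List.Relation.Unary.Any using (here; there; _─_)
open import Data.List.Relation.Unary.All as All using ([])
open import Data.List.Relation.Unary.Unique.Propositional using (Unique; []; _∷_)
import Data.List.Relation.Unary.Unique.Propositional.Properties as Unique
open import Data.Vec as Vec using (Vec; []; _∷_; lookup; tabulate; _[_]≔_)
open import Data.Vec.Properties
  using (∷-injective; lookup∘tabulate; tabulate∘lookup; lookup∘update; lookup∘update′;
         []≔-idempotent; []≔-lookup)
import Data.Vec.Relation.Unary.All as VecAll
import Data.Vec.Relation.Unary.All.Properties as VecAllP
open import Data.Vec.Relation.Binary.Pointwise.Inductive as Pointwise using (Pointwise)
open import Data.Maybe using (just; nothing)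
open import Data.Product using (_×_; _,_; proj₁; proj₂; ∃; ∃₂)
open import Data.Sum using (_⊎_; inj₁; inj₂)
open import Data.Empty using (⊥-elim)
open import Relation.Nullary using (yes; no)
open import Relation.Nullary.Decidable using (⌊_⌋)
open import Function using (_∘_)
open import Relation.Binary.PropositionalEquality

*≤*⇒/≤/ : ∀ m n c d .{{_ : NonZero c}} .{{_ : NonZero d}} →
          m * d ℕ.≤ n * c → (+ m) / c ≤ (+ n) / d
*≤*⇒/≤/ m n (suc c) (suc d) m*d≤n*c = toℚᵘ-cancel-≤
  (ℚᵘ.≤-respʳ-≃ (ℚᵘ.≃-sym (toℚᵘ-fromℚᵘ (mkℚᵘ (+ n) d)))
  (ℚᵘ.≤-respˡ-≃ (ℚᵘ.≃-sym (toℚᵘ-fromℚᵘ (mkℚᵘ (+ m) c)))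
    (*≤* (subst₂ ℤ._≤_ (pos-* m (suc d)) (pos-* n (suc c)) (+≤+ m*d≤n*c)))))

≤*⇒*suc≤*+ : ∀ x y a → x ℕ.≤ a * y → x * suc a ℕ.≤ a * (x + y)
≤*⇒*suc≤*+ x y a x≤a*y = begin
  x * suc a      ≡⟨ ℕ.*-suc x a ⟩
  x + x * a      ≤⟨ ℕ.+-monoˡ-≤ (x * a) x≤a*y ⟩
  a * y + x * a  ≡⟨ ℕ.+-comm (a * y) (x * a) ⟩
  x * a + a * y  ≡⟨ cong (_+ a * y) (ℕ.*-comm x a) ⟩
  a * x + a * y  ≡⟨ ℕ.*-distribˡ-+ a x y ⟨
  a * (x + y)    ∎
  where open ℕ.≤-Reasoning

module _ {a} {X : Set a} where

  length-filter-split : ∀ (E F : X → Bool) xs →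
    length (filter (λ x → T? (F x)) xs) ≡
    length (filter (λ x → T? (E x ∧ F x)) xs) + length (filter (λ x → T? (not (E x) ∧ F x)) xs)
  length-filter-split E F [] = refl
  length-filter-split E F (x ∷ xs) with E x | F x
  ... | true  | true  = cong suc (length-filter-split E F xs)
  ... | false | true  = trans (cong suc (length-filter-split E F xs)) (sym (ℕ.+-suc _ _))
  ... | true  | false = length-filter-split E F xs
  ... | false | false = length-filter-split E F xs

  ∈-─ : ∀ {x z : X} {ys} (x∈ys : x ∈ ys) → z ∈ ys → z ≢ x → z ∈ (ys ─ x∈ys)
  ∈-─ (here refl) (here refl) z≢x = ⊥-elim (z≢x refl)
  ∈-─ (here refl) (there z∈ys) _  = z∈ys
  ∈-─ (there _)   (here z≡y)  _   = here z≡y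
  ∈-─ (there x∈ys) (there z∈ys) z≢x = there (∈-─ x∈ys z∈ys z≢x)

  Unique⇒⊆⇒length≤ : ∀ {xs ys : List X} → Unique xs → xs ⊆ ys → length xs ℕ.≤ length ys
  Unique⇒⊆⇒length≤ {[]}     _             _     = ℕ.z≤n
  Unique⇒⊆⇒length≤ {x ∷ xs} {ys} (x∉xs ∷ u) xs⊆ys = begin
    suc (length xs)           ≤⟨ ℕ.s≤s (Unique⇒⊆⇒length≤ u xs⊆ys─x) ⟩
    suc (length (ys ─ x∈ys))  ≡⟨ length-removeAt′ ys _ ⟨
    length ys                 ∎
    where
    open ℕ.≤-Reasoning
    x∈ys = xs⊆ys (here refl)
    xs⊆ys─x : xs ⊆ (ys ─ x∈ys)
    xs⊆ys─x z∈xs = ∈-─ x∈ys (xs⊆ys (there z∈xs)) (λ { refl → All.lookup x∉xs z∈xs refl })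

length-cartesianProductWith : ∀ {a b c} {X : Set a} {Y : Set b} {Z : Set c}
  (f : X → Y → Z) xs ys → length (cartesianProductWith f xs ys) ≡ length xs * length ys
length-cartesianProductWith f []       ys = refl
length-cartesianProductWith f (x ∷ xs) ys = begin
  length (map (f x) ys ++ cartesianProductWith f xs ys)  ≡⟨ length-++ (map (f x) ys) ⟩
  length (map (f x) ys) + length (cartesianProductWith f xs ys)
    ≡⟨ cong₂ _+_ (length-map (f x) ys) (length-cartesianProductWith f xs ys) ⟩
  length ys + length xs * length ys  ∎
  where open ≡-Reasoning

elements : ∀ {n} → Subset n → List (Fin n)
elements []          = []
elements (true ∷ p)  = Fin.zero ∷ map Fin.suc (elements p)
elements (false ∷ p) = map Fin.suc (elements p)

length-elements : ∀ {n} (p : Subset n) → length (elements p) ≡ ∣ p ∣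
length-elements []          = refl
length-elements (true ∷ p)  = cong suc (trans (length-map Fin.suc (elements p)) (length-elements p))
length-elements (false ∷ p) = trans (length-map Fin.suc (elements p)) (length-elements p)

∈-elements : ∀ {n} {x : Fin n} {p} → x Subset.∈ p → x ∈ elements p
∈-elements {p = true ∷ p}  Vec.here       = here refl
∈-elements {p = true ∷ p}  (Vec.there x∈p) = there (∈-map⁺ Fin.suc (∈-elements x∈p))
∈-elements {p = false ∷ p} (Vec.there x∈p) = ∈-map⁺ Fin.suc (∈-elements x∈p)

module _ {X : Set} where

  product-∷ : ∀ {m} os (oss : Vec (List X) m) →
              product (os ∷ oss) ≡ cartesianProductWith _∷_ os (product oss)
  product-∷ []       oss = refl
  product-∷ (o ∷ os) oss = cong (map (o ∷_) (product oss) ++_) (product-∷ os oss)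

  ∈-product⁺ : ∀ {m} {xs : Vec X m} {oss} → Pointwise _∈_ xs oss → xs ∈ product oss
  ∈-product⁺ Pointwise.[]                        = here refl
  ∈-product⁺ {oss = os ∷ oss} (x∈os Pointwise.∷ xs∈oss) rewrite product-∷ os oss =
    ∈-cartesianProductWith⁺ _∷_ x∈os (∈-product⁺ xs∈oss)

  ∈-product⁻ : ∀ {m} {xs : Vec X m} oss → xs ∈ product oss → Pointwise _∈_ xs oss
  ∈-product⁻ {xs = []}     []         _ = Pointwise.[]
  ∈-product⁻ {xs = x ∷ xs} (os ∷ oss) xs∈
    rewrite product-∷ os oss
    with ∈-cartesianProductWith⁻ _∷_ os (product oss) xs∈
  ... | _ , _ , o∈os , ys∈ , refl = o∈os Pointwise.∷ ∈-product⁻ oss ys∈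

  product-unique : ∀ {m} {oss : Vec (List X) m} → VecAll.All Unique oss → Unique (product oss)
  product-unique VecAll.[] = [] ∷ []
  product-unique {oss = os ∷ oss} (os-unique VecAll.∷ oss-unique) rewrite product-∷ os oss =
    Unique.cartesianProductWith⁺ _∷_ ∷-injective os-unique (product-unique oss-unique)

module _ {n} (G : Graph n) where

  ∈-neighbours⁺ : ∀ {y w} → T (adj G y w) → y ∈ neighbours G w
  ∈-neighbours⁺ {y} {w} = ∈-filter⁺ (λ x → T? (adj G x w)) (∈-allFin y)

  ∈-neighbours⁻ : ∀ {y w} → y ∈ neighbours G w → T (adj G y w)
  ∈-neighbours⁻ {w = w} = proj₂ ∘ ∈-filter⁻ (λ x → T? (adj G x w)) {xs = allFin n}

  adj⇒just∈options : ∀ {y w} → T (adj G y w) → just y ∈ options G w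
  adj⇒just∈options {y} {w} y~w with neighbours G w | ∈-neighbours⁺ {y} {w} y~w
  ... | x ∷ xs | y∈ = ∈-map⁺ just y∈

  just∈options⇒adj : ∀ {y w} → just y ∈ options G w → T (adj G y w)
  just∈options⇒adj {y} {w} y∈ with neighbours G w | ∈-neighbours⁻ {y} {w}
  ... | []     | _       with y∈
  ...   | here ()
  ...   | there ()
  just∈options⇒adj y∈ | x ∷ xs | ∈⇒adj with ∈-map⁻ just y∈
  ... | _ , y∈nbs , refl = ∈⇒adj y∈nbs

  options-unique : ∀ w → Unique (options G w)
  options-unique w with neighbours G w | Unique.filter⁺ (λ x → T? (adj G x w)) (Unique.allFin⁺ n)
  ... | []     | _         = [] ∷ []
  ... | x ∷ xs | nbs-unique = Unique.map⁺ (λ { refl → refl }) nbs-unique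

  samples-unique : Unique (samples G)
  samples-unique = product-unique (VecAllP.tabulate⁺ options-unique)

  ∈-samples⁺ : ∀ (s : Sample n) → (∀ i → lookup s i ∈ options G i) → s ∈ samples G
  ∈-samples⁺ s valid = ∈-product⁺ (subst (λ s → Pointwise _∈_ s (tabulate (options G)))
    (tabulate∘lookup s) (Pointwise.tabulate⁺ valid))

  ∈-samples⁻ : ∀ {s : Sample n} → s ∈ samples G → ∀ i → lookup s i ∈ options G i
  ∈-samples⁻ s∈ i = subst (_ ∈_) (lookup∘tabulate (options G) i)
    (Pointwise.lookup (∈-product⁻ (tabulate (options G)) s∈) i)

module _ {n} {x : Fin n} where

  ∈ᵇ≡true⇒∈ : ∀ {S} → (x ∈ᵇ S) ≡ true → x Subset.∈ S
  ∈ᵇ≡true⇒∈ {S} x∈S with x ∈? S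
  ... | yes x∈S = x∈S

  ∈ᵇ⁅⁆⇒≡ : ∀ {y} → (x ∈ᵇ ⁅ y ⁆) ≡ true → x ≡ y
  ∈ᵇ⁅⁆⇒≡ {y} = x∈⁅y⁆⇒x≡y y ∘ ∈ᵇ≡true⇒∈

  ∈⇒∈ᵇ≡true : ∀ {S} → x Subset.∈ S → (x ∈ᵇ S) ≡ true
  ∈⇒∈ᵇ≡true {S} x∈S with x ∈? S
  ... | yes _   = refl
  ... | no  x∉S = ⊥-elim (x∉S x∈S)

  ∉⇒∈ᵇ≡false : ∀ {S} → x Subset.∉ S → (x ∈ᵇ S) ≡ false
  ∉⇒∈ᵇ≡false {S} x∉S with x ∈? S
  ... | yes x∈S = ⊥-elim (x∉S x∈S)
  ... | no  _   = refl

  ∈ˡ-head : ∀ vis → (x ∈ˡ (x ∷ vis)) ≡ true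
  ∈ˡ-head vis with x ≟ x
  ... | yes _   = refl
  ... | no  x≢x = ⊥-elim (x≢x refl)

  ∈ˡ-tail : ∀ y vis → (x ∈ˡ vis) ≡ true → (x ∈ˡ (y ∷ vis)) ≡ true
  ∈ˡ-tail y vis x∈vis with y ≟ x
  ... | yes _ = refl
  ... | no  _ = x∈vis

  ∉ˡ-tail : ∀ y vis → (x ∈ˡ (y ∷ vis)) ≡ false → (x ∈ˡ vis) ≡ false
  ∉ˡ-tail y vis x∉ with y ≟ x
  ... | no _ = x∉

∈ᵇ-⊥ : ∀ {n} (x : Fin n) → (x ∈ᵇ ⊥) ≡ false
∈ᵇ-⊥ x = ∉⇒∈ᵇ≡false ∉⊥

separates⇒≢ : ∀ {a} {X : Set a} (f : X → Bool) {x y} → f x ≡ true → f y ≡ false → x ≢ y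
separates⇒≢ f fx fy refl with () ← trans (sym fx) fy

-- A proof named x←y has type lookup s x ≡ just y: the live edge of x comes from y.

module _ {n} (s : Sample n) (P B : Subset n) where

  walk-suc : ∀ k vis x {y} → lookup s x ≡ just y →
             walk s P B (suc k) vis x ≡
               (if y ∈ˡ vis then false else if y ∈ᵇ P then true
                else if y ∈ᵇ B then false else walk s P B k (y ∷ vis) y)
  walk-suc k vis x x←y rewrite x←y = refl

  walk-revisit : ∀ k vis x {y} → lookup s x ≡ just y → (y ∈ˡ vis) ≡ true →
                 walk s P B k vis x ≡ false
  walk-revisit zero    vis x x←y y∈vis = refl
  walk-revisit (suc k) vis x x←y y∈vis rewrite walk-suc k vis x x←y | y∈vis = refl

  walk-arrive : ∀ k vis x {y} → lookup s x ≡ just y → (y ∈ˡ vis) ≡ false → (y ∈ᵇ P) ≡ true →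
                walk s P B (suc k) vis x ≡ true
  walk-arrive k vis x x←y y∉vis y∈P rewrite walk-suc k vis x x←y | y∉vis | y∈P = refl

  walk-continue : ∀ k vis x {y} → lookup s x ≡ just y → (y ∈ˡ vis) ≡ false →
                  (y ∈ᵇ P) ≡ false → (y ∈ᵇ B) ≡ false →
                  walk s P B (suc k) vis x ≡ walk s P B k (y ∷ vis) y
  walk-continue k vis x x←y y∉vis y∉P y∉B
    rewrite walk-suc k vis x x←y | y∉vis | y∉P | y∉B = refl

  data Unfolding (k : ℕ) (vis : List (Fin n)) (x : Fin n) : Set where
    arrive   : ∀ {y} → lookup s x ≡ just y → (y ∈ˡ vis) ≡ false → (y ∈ᵇ P) ≡ true →
               Unfolding k vis x
    continue : ∀ {y} → lookup s x ≡ just y → (y ∈ˡ vis) ≡ false →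
               (y ∈ᵇ P) ≡ false → (y ∈ᵇ B) ≡ false → walk s P B k (y ∷ vis) y ≡ true →
               Unfolding k vis x

  unfold : ∀ k vis x → walk s P B (suc k) vis x ≡ true → Unfolding k vis x
  unfold k vis x W with lookup s x in x←y
  ... | nothing with () ← W
  ... | just y with y ∈ˡ vis in y∈vis | y ∈ᵇ P in y∈P | y ∈ᵇ B in y∈B
  ...   | true  | _     | _     with () ← W
  ...   | false | true  | _     = arrive x←y y∈vis y∈P
  ...   | false | false | true  with () ← W
  ...   | false | false | false = continue x←y y∈vis y∈P y∈B W

-- scan stop s k w x follows the reverse walk from x, where w is the vertex visited before x,
-- and returns (w′ , z) for the first vertex z whose live edge comes from some y with stop w′ y,
-- w′ being the vertex visited before z.
scan : ∀ {n} → (Fin n → Fin n → Bool) → Sample n → ℕ → Fin n → Fin n → Fin n × Fin n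
scan stop s zero    w x = w , x
scan stop s (suc k) w x with lookup s x
... | nothing = w , x
... | just y  = if stop w y then (w , x) else scan stop s k x y

module _ {n} (stop : Fin n → Fin n → Bool) (s : Sample n) where

  scan-stop : ∀ k w x {y} → lookup s x ≡ just y → stop w y ≡ true →
              scan stop s (suc k) w x ≡ (w , x)
  scan-stop k w x x←y stops rewrite x←y | stops = refl

  scan-pass : ∀ k w x {y} → lookup s x ≡ just y → stop w y ≡ false →
              scan stop s (suc k) w x ≡ scan stop s k x y
  scan-pass k w x x←y passes rewrite x←y | passes = refl

hits : ∀ {n} → Subset n → Fin n → Fin n → Bool
hits P _ y = y ∈ᵇ P

returnsTo : ∀ {n} → Fin n → Fin n → Bool
returnsTo w y = ⌊ y ≟ w ⌋

returnsTo-refl : ∀ {n} (w : Fin n) → returnsTo w w ≡ true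
returnsTo-refl w with w ≟ w
... | yes _   = refl
... | no  w≢w = ⊥-elim (w≢w refl)

returnsTo-≢ : ∀ {n} {w y : Fin n} → y ≢ w → returnsTo w y ≡ false
returnsTo-≢ {w = w} {y} y≢w with y ≟ w
... | yes y≡w = ⊥-elim (y≢w y≡w)
... | no  _   = refl

≢-tails : ∀ {n} (s : Sample n) {x z y a} →
          lookup s x ≡ just y → lookup s z ≡ just a → y ≢ a → x ≢ z
≢-tails s x←y z←a y≢a refl with refl ← trans (sym x←y) z←a = y≢a refl

reachAvoid-∉ : ∀ {n} (s : Sample n) P B w → (w ∈ᵇ P) ≡ false →
               reachAvoid s P B w ≡ walk s P B n (w ∷ []) w
reachAvoid-∉ s P B w w∉P rewrite w∉P = refl

module _ {n} (P B : Subset n) where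

  scan-hits-entry : ∀ (s : Sample n) k vis w x → walk s P B k vis x ≡ true →
    (x ∈ᵇ P) ≡ false → (x ∈ᵇ B) ≡ false →
    let z = proj₂ (scan (hits P) s k w x) in
    (z ∈ᵇ P) ≡ false × (z ∈ᵇ B) ≡ false × ∃ λ y → lookup s z ≡ just y × (y ∈ᵇ P) ≡ true
  scan-hits-entry s (suc k) vis w x W x∉P x∉B with unfold s P B k vis x W
  ... | arrive {y} x←y _ y∈P rewrite scan-stop (hits P) s k w x x←y y∈P =
    x∉P , x∉B , y , x←y , y∈P
  ... | continue {y} x←y _ y∉P y∉B W′ rewrite scan-pass (hits P) s k w x x←y y∉P =
    scan-hits-entry s k (y ∷ vis) x y W′ y∉P y∉B

  update-off-walk : ∀ (s : Sample n) {z a} m k vis w x →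
    lookup s z ≡ just a → (a ∈ᵇ P) ≡ false → (a ∈ᵇ B) ≡ true → walk s P B k vis x ≡ true →
    walk (s [ z ]≔ m) P B k vis x ≡ true × scan (hits P) (s [ z ]≔ m) k w x ≡ scan (hits P) s k w x
  update-off-walk s {z} m (suc k) vis w x z←a a∉P a∈B W with unfold s P B k vis x W
  ... | arrive {y} x←y y∉vis y∈P =
    walk-arrive t P B k vis x t:x←y y∉vis y∈P ,
    trans (scan-stop (hits P) t k w x t:x←y y∈P) (sym (scan-stop (hits P) s k w x x←y y∈P))
    where
    t = s [ z ]≔ m
    t:x←y : lookup t x ≡ just y
    t:x←y = trans (lookup∘update′ (≢-tails s x←y z←a (separates⇒≢ (_∈ᵇ P) y∈P a∉P)) s m) x←y
  ... | continue {y} x←y y∉vis y∉P y∉B W′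
    with update-off-walk s m k (y ∷ vis) x y z←a a∉P a∈B W′
  ... | t-walk , t-scan =
    trans (walk-continue t P B k vis x t:x←y y∉vis y∉P y∉B) t-walk ,
    trans (scan-pass (hits P) t k w x t:x←y y∉P)
          (trans t-scan (sym (scan-pass (hits P) s k w x x←y y∉P)))
    where
    t = s [ z ]≔ m
    t:x←y : lookup t x ≡ just y
    t:x←y = trans (lookup∘update′ (≢-tails s x←y z←a (≢-sym (separates⇒≢ (_∈ᵇ B) a∈B y∉B))) s m) x←y

module _ {n} (A : Subset n) where

  -- z-fresh is only the invariant that carries the induction in scan-hits-switch.
  record Switch (s : Sample n) (k : ℕ) (vis : List (Fin n)) (w x w′ z : Fin n) : Set where
    field
      w′←z          : lookup s w′ ≡ just z
      tail          : Fin n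
      z←tail        : lookup s z ≡ just tail
      tail∈A        : (tail ∈ᵇ A) ≡ true
      z-fresh       : z ≡ x ⊎ (z ∈ˡ vis) ≡ false
      switched-walk : walk (s [ z ]≔ just w′) A ⊥ k vis x ≡ false
      switched-scan : proj₂ (scan returnsTo (s [ z ]≔ just w′) k w x) ≡ z

  switch-here : ∀ (s : Sample n) k vis w x {y} → lookup s x ≡ just y → (y ∈ᵇ A) ≡ true →
    lookup s w ≡ just x → w ≢ x → (w ∈ᵇ A) ≡ false → (x ∈ˡ vis) ≡ true →
    Switch s (suc k) vis w x w x
  switch-here s k vis w x {y} x←y y∈A w←x w≢x w∉A x∈vis = record
    { w′←z          = w←x
    ; tail          = y
    ; z←tail        = x←y
    ; tail∈A        = y∈A
    ; z-fresh       = inj₁ refl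
    ; switched-walk = cut
    ; switched-scan = cong proj₂ (scan-stop returnsTo t k w x t:x←w (returnsTo-refl w))
    }
    where
    t = s [ x ]≔ just w
    t:x←w : lookup t x ≡ just w
    t:x←w = lookup∘update x s (just w)
    cut : walk t A ⊥ (suc k) vis x ≡ false
    cut with w ∈ˡ vis in w∈vis
    ... | true  = walk-revisit t A ⊥ (suc k) vis x t:x←w w∈vis
    ... | false = trans (walk-continue t A ⊥ k vis x t:x←w w∈vis w∉A (∈ᵇ-⊥ w))
                        (walk-revisit t A ⊥ k (w ∷ vis) w (trans (lookup∘update′ w≢x s (just w)) w←x)
                                      (∈ˡ-tail w vis x∈vis))

  switch-step : ∀ (s : Sample n) k vis w x {y w′ z} → Switch s k (y ∷ vis) x y w′ z →
    lookup s x ≡ just y → (y ∈ˡ vis) ≡ false → (y ∈ᵇ A) ≡ false → (x ∈ˡ vis) ≡ true → y ≢ w →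
    Switch s (suc k) vis w x w′ z
  switch-step s k vis w x {y} {w′} {z} sw x←y y∉vis y∉A x∈vis y≢w = record
    { w′←z          = w′←z
    ; tail          = tail
    ; z←tail        = z←tail
    ; tail∈A        = tail∈A
    ; z-fresh       = inj₂ z∉vis
    ; switched-walk = trans (walk-continue t A ⊥ k vis x t:x←y y∉vis y∉A (∈ᵇ-⊥ y)) switched-walk
    ; switched-scan = trans (cong proj₂ (scan-pass returnsTo t k w x t:x←y (returnsTo-≢ y≢w)))
                            switched-scan
    }
    where
    open Switch sw
    t = s [ z ]≔ just w′
    z∉vis : (z ∈ˡ vis) ≡ false
    x≢z : x ≢ z
    z∉vis with z-fresh
    ... | inj₁ refl = y∉vis
    ... | inj₂ z∉   = ∉ˡ-tail y vis z∉
    x≢z with z-fresh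
    ... | inj₁ refl = separates⇒≢ (_∈ˡ vis) x∈vis y∉vis
    ... | inj₂ z∉   = separates⇒≢ (_∈ˡ (y ∷ vis)) (∈ˡ-tail y vis x∈vis) z∉
    t:x←y : lookup t x ≡ just y
    t:x←y = trans (lookup∘update′ x≢z s (just w′)) x←y

  scan-hits-switch : ∀ (s : Sample n) k vis w x → walk s A ⊥ k vis x ≡ true →
    lookup s w ≡ just x → w ≢ x → (w ∈ᵇ A) ≡ false → (x ∈ᵇ A) ≡ false → (x ∈ˡ vis) ≡ true →
    Switch s k vis w x (proj₁ (scan (hits A) s k w x)) (proj₂ (scan (hits A) s k w x))
  scan-hits-switch s (suc k) vis w x W w←x w≢x w∉A x∉A x∈vis with unfold s A ⊥ k vis x W
  ... | arrive x←y _ y∈A rewrite scan-stop (hits A) s k w x x←y y∈A =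
    switch-here s k vis w x x←y y∈A w←x w≢x w∉A x∈vis
  ... | continue {y} x←y y∉vis y∉A _ W′ rewrite scan-pass (hits A) s k w x x←y y∉A =
    switch-step s k vis w x
      (scan-hits-switch s k (y ∷ vis) x y W′ x←y x≢y x∉A y∉A (∈ˡ-head vis))
      x←y y∉vis y∉A x∈vis y≢w
    where
    x≢y = separates⇒≢ (_∈ˡ vis) x∈vis y∉vis
    y≢w : y ≢ w
    y≢w refl with () ← trans (sym (walk-revisit s A ⊥ k (y ∷ vis) y w←x (∈ˡ-tail y vis x∈vis))) W′

reverse-∈-samples : ∀ {n} (G : Graph n) {s w z} → s ∈ samples G → lookup s w ≡ just z →
                    s [ z ]≔ just w ∈ samples G
reverse-∈-samples G {s} {w} {z} s∈ w←z = ∈-samples⁺ G _ valid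
  where
  valid : ∀ i → lookup (s [ z ]≔ just w) i ∈ options G i
  valid i with i ≟ z
  ... | yes refl = subst (_∈ options G z) (sym (lookup∘update z s (just w)))
    (adj⇒just∈options G (subst T (adj-sym G z w)
      (just∈options⇒adj G (subst (_∈ options G w) w←z (∈-samples⁻ G s∈ w)))))
  ... | no  i≢z  = subst (_∈ options G i) (sym (lookup∘update′ i≢z s (just w))) (∈-samples⁻ G s∈ i)

module _ {n} (A : Subset n) (u v : Fin n) where

  entry : Sample n → Fin n
  entry s = proj₂ (scan (hits ⁅ u ⁆) s n v v)

  restore : Fin n → Sample n → Sample n
  restore a t = t [ proj₂ (scan returnsTo t n (entry t) u) ]≔ just a

  switch-decomposition : ∀ (G : Graph n) → u ≢ v → u Subset.∉ A → v Subset.∉ A →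
    ∀ {s} → s ∈ samples G → reach s A u ≡ true → reachAvoid s ⁅ u ⁆ A v ≡ true →
    ∃₂ λ a t → a Subset.∈ A × t ∈ samples G × reach t A u ≡ false ×
               reachAvoid t ⁅ u ⁆ A v ≡ true × restore a t ≡ s
  switch-decomposition G u≢v u∉A v∉A {s} s∈ Es Fs =
    tail , t , ∈ᵇ≡true⇒∈ tail∈A , reverse-∈-samples G s∈ w′←z ,
    trans (reachAvoid-∉ t A ⊥ u u∉ᵇA) switched-walk ,
    trans (reachAvoid-∉ t ⁅ u ⁆ A v v∉ᵇ⁅u⁆) (proj₁ t-avoids) ,
    restores
    where
    u∉ᵇA = ∉⇒∈ᵇ≡false u∉A
    v∉ᵇ⁅u⁆ : (v ∈ᵇ ⁅ u ⁆) ≡ false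
    v∉ᵇ⁅u⁆ = ∉⇒∈ᵇ≡false (u≢v ∘ sym ∘ x∈⁅y⁆⇒x≡y u)
    F-walk = trans (sym (reachAvoid-∉ s ⁅ u ⁆ A v v∉ᵇ⁅u⁆)) Fs
    p = entry s
    p-entry = scan-hits-entry ⁅ u ⁆ A s n (v ∷ []) v v F-walk v∉ᵇ⁅u⁆ (∉⇒∈ᵇ≡false v∉A)
    p←u : lookup s p ≡ just u
    p←u with p-entry
    ... | _ , _ , y , p←y , y∈⁅u⁆ = trans p←y (cong just (∈ᵇ⁅⁆⇒≡ y∈⁅u⁆))
    p≢u : p ≢ u
    p≢u = ≢-sym (separates⇒≢ (_∈ᵇ ⁅ u ⁆) (∈⇒∈ᵇ≡true (x∈⁅x⁆ u)) (proj₁ p-entry))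
    sw = scan-hits-switch A s n (u ∷ []) p u (trans (sym (reachAvoid-∉ s A ⊥ u u∉ᵇA)) Es)
           p←u p≢u (proj₁ (proj₂ p-entry)) u∉ᵇA (∈ˡ-head [])
    open Switch sw
    w′ = proj₁ (scan (hits A) s n p u)
    z  = proj₂ (scan (hits A) s n p u)
    t  = s [ z ]≔ just w′
    tail∉⁅u⁆ : (tail ∈ᵇ ⁅ u ⁆) ≡ false
    tail∉⁅u⁆ = ∉⇒∈ᵇ≡false λ tail∈⁅u⁆ →
      u∉A (subst (Subset._∈ A) (x∈⁅y⁆⇒x≡y u tail∈⁅u⁆) (∈ᵇ≡true⇒∈ tail∈A))
    t-avoids = update-off-walk ⁅ u ⁆ A s (just w′) n (v ∷ []) v v z←tail tail∉⁅u⁆ tail∈A F-walk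
    restores : restore tail t ≡ s
    restores = begin
      t [ proj₂ (scan returnsTo t n (entry t) u) ]≔ just tail
        ≡⟨ cong (λ q → t [ proj₂ (scan returnsTo t n q u) ]≔ just tail)
                (cong proj₂ (proj₂ t-avoids)) ⟩
      t [ proj₂ (scan returnsTo t n p u) ]≔ just tail
        ≡⟨ cong (λ q → t [ q ]≔ just tail) switched-scan ⟩
      t [ z ]≔ just tail                                ≡⟨ []≔-idempotent s z ⟩
      s [ z ]≔ just tail                                ≡⟨ cong (s [ z ]≔_) z←tail ⟨
      s [ z ]≔ lookup s z                               ≡⟨ []≔-lookup s z ⟩
      s                                                 ∎
      where open ≡-Reasoning

  switch-cover : ∀ (G : Graph n) → u ≢ v → u Subset.∉ A → v Subset.∉ A →
    filter (λ s → T? (reach s A u ∧ reachAvoid s ⁅ u ⁆ A v)) (samples G) ⊆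
    cartesianProductWith restore (elements A)
      (filter (λ s → T? (not (reach s A u) ∧ reachAvoid s ⁅ u ⁆ A v)) (samples G))
  switch-cover G u≢v u∉A v∉A s∈EF
    with s∈ , EFs ← ∈-filter⁻ (λ s → T? (reach s A u ∧ reachAvoid s ⁅ u ⁆ A v))
                              {xs = samples G} s∈EF
    with Es , Fs ← Equivalence.to T-∧ EFs
    with switch-decomposition G u≢v u∉A v∉A s∈ (Equivalence.to T-≡ Es) (Equivalence.to T-≡ Fs)
  ... | a , t , a∈A , t∈ , ¬Et , Ft , refl =
    ∈-cartesianProductWith⁺ restore (∈-elements a∈A)
      (∈-filter⁺ (λ s → T? (not (reach s A u) ∧ reachAvoid s ⁅ u ⁆ A v)) t∈
        (Equivalence.from T-≡ (cong₂ (λ b c → not b ∧ c) ¬Et Ft)))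

lemma9 : ∀ {n} (G : Graph n) (A : Subset n) (u v : Fin n)
         → u ≢ v → u ∉ A → v ∉ A
         → (pos : count G (λ s → reachAvoid s ⁅ u ⁆ A v) > 0)
         → condPr G (λ s → reach s A u) (λ s → reachAvoid s ⁅ u ⁆ A v) pos
           ≤ (+ ∣ A ∣) / suc ∣ A ∣
lemma9 {n} G A u v u≢v u∉A v∉A pos =
  *≤*⇒/≤/ (length X) ∣ A ∣ (count G F) (suc ∣ A ∣) {{ℕ.>-nonZero pos}}
    (subst (λ c → length X * suc ∣ A ∣ ℕ.≤ ∣ A ∣ * c) (sym (length-filter-split E F (samples G)))
      (≤*⇒*suc≤*+ (length X) (length Y) ∣ A ∣ X≤A*Y))
  where
  E F : Sample n → Bool
  E s = reach s A u
  F s = reachAvoid s ⁅ u ⁆ A v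
  X = filter (λ s → T? (E s ∧ F s)) (samples G)
  Y = filter (λ s → T? (not (E s) ∧ F s)) (samples G)
  X≤A*Y : length X ℕ.≤ ∣ A ∣ * length Y
  X≤A*Y = begin
    length X
      ≤⟨ Unique⇒⊆⇒length≤ (Unique.filter⁺ (λ s → T? (E s ∧ F s)) (samples-unique G))
                           (switch-cover A u v G u≢v u∉A v∉A) ⟩
    length (cartesianProductWith (restore A u v) (elements A) Y)
      ≡⟨ length-cartesianProductWith (restore A u v) (elements A) Y ⟩
    length (elements A) * length Y  ≡⟨ cong (_* length Y) (length-elements A) ⟩
    ∣ A ∣ * length Y                 ∎
    where open ℕ.≤-Reasoning
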